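{- Let $G'=(V',E')$ be a graph and $k'$ an integer, and let $(G,k)$ be the instance constructed from $(G',k')$ as described in the context. Suppose $(G,k)$ is a yes-instance of \textsc{Optimal Hub Labeling}. Then there is an optimal hub labeling $\ell$ of $G$ such that (1) for all $u,v\in V$ with $N_G[u]\subsetneq N_G[v]$, we have $u\notin\ell(v)$; (2) $\{x\in V\mid w\in\ell(x)\}=V$, and for every $x\in W$, $\{y\in V\mid x\in\ell(y)\}=\{x\}$; (3) for all $v\in V'$, if $v_1\in\ell(v_2)$ then $|\ell_v|>2$; (4) for all $uv\in E'$, if $u_1\notin\ell(u_2)$ and $v_1\notin\ell(v_2)$ then $|\ell_{uv}|>3$.
   Context: \textsc{Optimal Hub Labeling}: given a graph $G=(V,E)$ and integer $k$, decide whether there is $\ell:V\to 2^V$ with $\sum_{v}|\ell(v)|\le k$ such that for all $u,v\in V$ (including $u=v$) some vertex of some shortest $u$-$v$-path in $G$ lies in $\ell(u)\cap\ell(v)$; such an $\ell$ is a hub labeling of $G$. The size of $\ell$ is $|\ell|=\sum_v|\ell(v)|$ (identifying $\ell$ with the set of pairs $(x,y)$, $y\in\ell(x)$), and $\ell$ is optimal if no hub labeling of $G$ has strictly smaller size. $N_G[u]$ is the closed neighborhood. Construction: from a graph $G'=(V',E')$ and integer $k'$, let $\gamma:=8|V'|+3|E'|+k'+2$, $W:=\{w_1,\dots,w_\gamma\}$, $V:=\{w\}\cup W\cup\{v_1,v_2,v_3\mid v\in V'\}$ (all new distinct vertices), $E:=\bigcup_{v\in V'}\{wv_1,v_1v_2,v_2v_3\}\cup\{wx\mid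 x\in W\}\cup\{u_1v_1\mid uv\in E'\}$, $G=(V,E)$, and $k:=3\gamma-1$. For a hub labeling $\ell$ of $G$: for $v\in V'$, $\ell_v:=\ell\cap\{(v_i,v_j)\mid i,j\in\{1,2,3\},i\ne j\}$; for $uv\in E'$, $\ell_{uv}:=\ell\cap\{(u_i,v_j),(v_j,u_i)\mid i,j\in\{1,2,3\}\}$. -}

module Defs where

open import Data.Nat using (ℕ; zero; suc; _+_; _*_; _∸_; _≤_; _<_)
open import Data.Fin using (Fin; toℕ)
open import Data.Bool using (Bool; true; false; if_then_else_)
open import Data.Nat.ListAction using (sum)
open import Data.List using (List; []; _∷_; _++_; map; allFin; cartesianProduct; concatMap)
open import Data.List.Membership.Propositional using (_∈_)
open import Data.Product using (Σ; ∃; _×_; _,_)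
open import Data.Sum using (_⊎_)
open import Relation.Nullary using (¬_; does)
open import Relation.Binary.PropositionalEquality using (_≡_)
open import Data.Nat.Properties using (_<?_)

module _ {V : Set} (E : V → V → Set) where

  data Walk : V → V → Set where
    []  : ∀ {u} → Walk u u
    _∷_ : ∀ {u x v} → E u x → Walk x v → Walk u v

  len : ∀ {u v} → Walk u v → ℕ
  len []      = 0
  len (_ ∷ p) = suc (len p)

  verts : ∀ {u v} → Walk u v → List V
  verts {u} []      = u ∷ []
  verts {u} (_ ∷ p) = u ∷ verts p

  Shortest : ∀ {u v} → Walk u v → Set
  Shortest {u} {v} p = ∀ (q : Walk u v) → len p ≤ len q

  OnShortestPath : V → V → V → Set
  OnShortestPath u v x = Σ (Walk u v) λ p → Shortest p × x ∈ verts p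

  -- a labeling ℓ : V → 2^V, given by characteristic functions:
  -- ℓ x y ≡ true  iff  y ∈ ℓ(x)
  IsHubLabeling : (V → V → Bool) → Set
  IsHubLabeling ℓ = ∀ (u v : V) →
    ∃ λ x → OnShortestPath u v x × ℓ u x ≡ true × ℓ v x ≡ true

  InN : V → V → Set
  InN u x = x ≡ u ⊎ E u x

  NStrictSub : V → V → Set
  NStrictSub u v = (∀ x → InN u x → InN v x) × (∃ λ x → InN v x × ¬ InN u x)

b2n : Bool → ℕ
b2n true  = 1
b2n false = 0

-- size |ℓ| = Σ_v |ℓ(v)|, w.r.t. an enumeration of V (each vertex once)
labelSize : {V : Set} → List V → (V → V → Bool) → ℕ
labelSize vs ℓ = sum (map (λ x → sum (map (λ y → b2n (ℓ x y)) vs)) vs)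

SimpleGraph : ℕ → Set
SimpleGraph n = Σ (Fin n → Fin n → Bool) λ a →
  (∀ u v → a u v ≡ a v u) × (∀ u → a u u ≡ false)

numEdges : ∀ {n} → (Fin n → Fin n → Bool) → ℕ
numEdges {n} a = sum (map (λ { (u , v) → if does (toℕ u <? toℕ v) then b2n (a u v) else 0 })
                          (cartesianProduct (allFin n) (allFin n)))

gammaOf : ∀ {n} → (Fin n → Fin n → Bool) → ℕ → ℕ
gammaOf {n} a k' = 8 * n + 3 * numEdges a + k' + 2

data Idx : Set where
  i1 i2 i3 : Idx

allIdx : List Idx
allIdx = i1 ∷ i2 ∷ i3 ∷ []

-- vertices of G : w, w_1..w_γ (W), and v_i for v ∈ V', i ∈ {1,2,3}
data CV (n γ : ℕ) : Set where
  hub : CV n γ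
  wv  : Fin γ → CV n γ
  vv  : Fin n → Idx → CV n γ

allCV : (n γ : ℕ) → List (CV n γ)
allCV n γ = hub ∷ map wv (allFin γ) ++ concatMap (λ v → map (vv v) allIdx) (allFin n)

data CAdj {n γ : ℕ} (a : Fin n → Fin n → Bool) : CV n γ → CV n γ → Set where
  w-v1  : ∀ v → CAdj a hub (vv v i1)
  v1-w  : ∀ v → CAdj a (vv v i1) hub
  v1-v2 : ∀ v → CAdj a (vv v i1) (vv v i2)
  v2-v1 : ∀ v → CAdj a (vv v i2) (vv v i1)
  v2-v3 : ∀ v → CAdj a (vv v i2) (vv v i3)
  v3-v2 : ∀ v → CAdj a (vv v i3) (vv v i2)
  w-W   : ∀ x → CAdj a hub (wv x)
  W-w   : ∀ x → CAdj a (wv x) hub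
  u1-v1 : ∀ u v → a u v ≡ true → CAdj a (vv u i1) (vv v i1)

ellV : ∀ {n γ} → (CV n γ → CV n γ → Bool) → Fin n → ℕ
ellV ℓ v =
  b2n (ℓ (vv v i1) (vv v i2)) + b2n (ℓ (vv v i1) (vv v i3)) +
  b2n (ℓ (vv v i2) (vv v i1)) + b2n (ℓ (vv v i2) (vv v i3)) +
  b2n (ℓ (vv v i3) (vv v i1)) + b2n (ℓ (vv v i3) (vv v i2))

ellUV : ∀ {n γ} → (CV n γ → CV n γ → Bool) → Fin n → Fin n → ℕ
ellUV ℓ u v = sum (map (λ { (i , j) → b2n (ℓ (vv u i) (vv v j)) + b2n (ℓ (vv v j) (vv u i)) })
                       (cartesianProduct allIdx allIdx))

-- Among the hub labelings in a normal form there is an optimal one, and properties (1)-(4) hold for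
-- every hub labeling in normal form. The normal form of a hub labeling ℓ puts w in every label, makes
-- each x ∈ W its only own hub besides w, and keeps ℓ on pairs of copies v_i, u_j, except that
-- (v₂, v₃) is exchanged for (v₃, v₂). It is again a hub labeling: distances in G are explicit, and
-- shortest paths run through w except inside a path v₁v₂v₃ or across an edge u₁v₁. It is no larger
-- than ℓ: every x ∈ W accounts for at least two pairs of ℓ, and for three as soon as some copy v_i
-- lacks w, which pays for the 3|V'| pairs (v_i, w) because γ ≥ 3|V'|. Normal forms are finitely
-- many, so one of minimum size exists.
module Submission where

open import Defs
open import Data.Nat using (ℕ; zero; suc; _+_; _*_; _∸_; _≤_; _<_; _≤ᵇ_; z≤n; s≤s; ∣_-_∣)
open import Data.Nat.Properties
open import Data.Nat.ListAction using (sum)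
open import Data.Nat.ListAction.Properties using (sum-++)
open import Data.Nat.Tactic.RingSolver using (solve-∀)
open import Data.Bool using (Bool; true; false; T; _∨_; if_then_else_)
import Data.Bool.Properties as Bool
open import Data.Fin using (Fin) renaming (zero to fzero; suc to fsuc)
import Data.Fin.Properties as Fin
open import Data.List using (List; []; _∷_; _++_; map; allFin; tabulate; concatMap; cartesianProduct; filter)
open import Data.List.Properties using (map-++; map-∘)
open import Data.List.Membership.Propositional using (_∈_; lose)
open import Data.List.Membership.Propositional.Properties
  using (∈-concatMap⁺; ∈-cartesianProduct⁺; ∈-allFin; ∈-filter⁺; ∈-map⁺; ∈-++⁺ˡ; ∈-++⁺ʳ)
open import Data.List.Relation.Unary.Any using (here; there)
import Data.List.Relation.Unary.Any as Any
import Data.List.Relation.Unary.All as All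
open import Data.List.Relation.Unary.All.Properties using (all-filter)
open import Data.List.Extrema.Nat using (argmin; argmin-all; f[argmin]≤f[xs])
open import Data.Product using (Σ; ∃; _×_; _,_; proj₁; proj₂)
import Data.Product.Properties as Product
open import Data.Sum using (_⊎_; inj₁; inj₂)
open import Data.Empty using (⊥-elim)
open import Function using (_∘_)
open import Function.Bundles using (_⇔_; mk⇔)
open import Relation.Nullary using (¬_; Dec; yes; no; does)
open import Relation.Nullary.Decidable using (map′; _×-dec_; dec-true; dec-false)
open import Relation.Binary.Definitions using (DecidableEquality)
open import Relation.Binary.PropositionalEquality
open import Algebra.Properties.CommutativeMonoid.Sum +-0-commutativeMonoid
  using (sum-syntax; ∑-distrib-+; ∑-comm; sum-replicate-zero; sum-cong-≗)

≤-eval : {m n : ℕ} {_ : T (m ≤ᵇ n)} → m ≤ n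
≤-eval {m} {n} {m≤ᵇn} = ≤ᵇ⇒≤ m n m≤ᵇn

1≤b2n : ∀ {b} → b ≡ true → 1 ≤ b2n b
1≤b2n refl = s≤s z≤n

1≤b2n-⊎ : ∀ {b c} → b ≡ true ⊎ c ≡ true → 1 ≤ b2n b + b2n c
1≤b2n-⊎ (inj₁ refl) = s≤s z≤n
1≤b2n-⊎ {b} (inj₂ refl) = m≤n+m 1 (b2n b)

b2n-∨ : ∀ b c → b2n (b ∨ c) ≤ b2n b + b2n c
b2n-∨ true  c = s≤s z≤n
b2n-∨ false c = ≤-refl

+-cancel-tail : ∀ b k i j → b + (k + j + 1) ≡ i + j + 1 → b + k ≡ i
+-cancel-tail b k i j eq = +-cancelʳ-≡ (j + 1) (b + k) i (trans (regroup b k j) (trans eq (+-assoc i j 1)))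
  where regroup : ∀ b k j → b + k + (j + 1) ≡ b + (k + j + 1)
        regroup = solve-∀

+-cancel-head : ∀ i k b j → (i + k + 1) + b ≡ i + j + 1 → b + k ≡ j
+-cancel-head i k b j eq = +-cancelˡ-≡ (i + 1) (b + k) j (trans (regroup i k b) (trans eq (regroup′ i j)))
  where regroup : ∀ i k b → i + 1 + (b + k) ≡ i + k + 1 + b
        regroup = solve-∀
        regroup′ : ∀ i j → i + j + 1 ≡ i + 1 + j
        regroup′ = solve-∀

∑-mono-≤ : ∀ {m} {f g : Fin m → ℕ} → (∀ i → f i ≤ g i) → ∑[ i < m ] f i ≤ ∑[ i < m ] g i
∑-mono-≤ {zero}  f≤g = z≤n
∑-mono-≤ {suc m} f≤g = +-mono-≤ (f≤g fzero) (∑-mono-≤ (f≤g ∘ fsuc))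

∑-const : ∀ m c → ∑[ i < m ] c ≡ m * c
∑-const zero    c = refl
∑-const (suc m) c = cong (c +_) (∑-const m c)

term≤∑ : ∀ {m} (f : Fin m → ℕ) i → f i ≤ ∑[ j < m ] f j
term≤∑ f fzero    = m≤m+n (f fzero) _
term≤∑ f (fsuc i) = ≤-trans (term≤∑ (f ∘ fsuc) i) (m≤n+m _ (f fzero))

two-terms≤∑ : ∀ {m} (f : Fin m → ℕ) {i j} → i ≢ j → f i + f j ≤ ∑[ k < m ] f k
two-terms≤∑ f {fzero}  {fzero}  0≢0 = ⊥-elim (0≢0 refl)
two-terms≤∑ f {fzero}  {fsuc j} _   = +-monoʳ-≤ (f fzero) (term≤∑ (f ∘ fsuc) j)
two-terms≤∑ f {fsuc i} {fzero}  _   =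
  ≤-trans (≤-reflexive (+-comm (f (fsuc i)) (f fzero))) (+-monoʳ-≤ (f fzero) (term≤∑ (f ∘ fsuc) i))
two-terms≤∑ f {fsuc i} {fsuc j} i≢j =
  ≤-trans (two-terms≤∑ (f ∘ fsuc) (i≢j ∘ cong fsuc)) (m≤n+m _ (f fzero))

distinct-pair : ∀ {m} → 2 ≤ m → ∃ λ (x : Fin m) → ∃ λ y → x ≢ y
distinct-pair (s≤s (s≤s _)) = fzero , fsuc fzero , λ ()

∑-indicator : ∀ {m} (i : Fin m) → ∑[ j < m ] b2n (does (i Fin.≟ j)) ≡ 1
∑-indicator {suc m} fzero    = cong suc (sum-replicate-zero m)
∑-indicator {suc m} (fsuc i) = ∑-indicator i

sum-map-tabulate : ∀ {A : Set} m (h : Fin m → A) (g : A → ℕ) → sum (map g (tabulate h)) ≡ ∑[ i < m ] g (h i)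
sum-map-tabulate zero    h g = refl
sum-map-tabulate (suc m) h g = cong (g (h fzero) +_) (sum-map-tabulate m (h ∘ fsuc) g)

sum-map-concatMap : ∀ {A B : Set} (g : B → ℕ) (k : A → List B) xs →
                    sum (map g (concatMap k xs)) ≡ sum (map (λ x → sum (map g (k x))) xs)
sum-map-concatMap g k []       = refl
sum-map-concatMap g k (x ∷ xs) = begin
  sum (map g (k x ++ concatMap k xs))               ≡⟨ cong sum (map-++ g (k x) (concatMap k xs)) ⟩
  sum (map g (k x) ++ map g (concatMap k xs))       ≡⟨ sum-++ (map g (k x)) _ ⟩
  sum (map g (k x)) + sum (map g (concatMap k xs))  ≡⟨ cong (sum (map g (k x)) +_) (sum-map-concatMap g k xs) ⟩
  sum (map g (k x)) + sum (map (λ x → sum (map g (k x))) xs) ∎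
  where open ≡-Reasoning

Complete : {A : Set} → List A → Set
Complete {A} xs = (x : A) → x ∈ xs

module _ {A : Set} {xs : List A} (xs-complete : Complete xs) {P : A → Set} (P? : ∀ x → Dec (P x)) where

  ∀-dec : Dec (∀ x → P x)
  ∀-dec = map′ (λ all x → All.lookup all (xs-complete x)) (λ all → All.tabulate (λ {x} _ → all x)) (All.all? P? xs)

  ∃-dec : Dec (∃ P)
  ∃-dec = map′ Any.satisfied (λ (x , px) → lose (xs-complete x) px) (Any.any? P? xs)

module _ {A : Set} (_≟_ : DecidableEquality A) where

  update : (A → Bool) → A → Bool → A → Bool
  update g x b y with y ≟ x
  ... | yes _ = b
  ... | no  _ = g y

  boolFunctions : List A → List (A → Bool)
  boolFunctions []       = (λ _ → false) ∷ []
  boolFunctions (x ∷ xs) = concatMap (λ g → update g x false ∷ update g x true ∷ []) (boolFunctions xs)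

  boolFunctions-complete : ∀ xs (t : A → Bool) →
                           ∃ λ g → g ∈ boolFunctions xs × (∀ y → y ∈ xs → g y ≡ t y)
  boolFunctions-complete []       t = (λ _ → false) , here refl , λ _ ()
  boolFunctions-complete (x ∷ xs) t with boolFunctions-complete xs t
  ... | g , g∈ , g≗t = update g x (t x) , ∈-concatMap⁺ _ (Any.map (λ { refl → choice (t x) }) g∈) , agrees
    where
      choice : ∀ b → update g x b ∈ update g x false ∷ update g x true ∷ []
      choice false = here refl
      choice true  = there (here refl)
      agrees : ∀ y → y ∈ x ∷ xs → update g x (t x) y ≡ t y
      agrees y y∈ with y ≟ x | y∈
      ... | yes refl | _        = refl
      ... | no  y≢x  | here y≡x = ⊥-elim (y≢x y≡x)
      ... | no  _    | there y∈xs = g≗t y y∈xs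

minimal-in : ∀ {A : Set} {P : A → Set} (P? : ∀ x → Dec (P x)) (key : A → ℕ) (xs : List A) {c} → P c →
             ∃ λ m → P m × (∀ x → x ∈ xs → P x → key m ≤ key x)
minimal-in {P = P} P? key xs {c} pc =
  argmin key c ys , argmin-all key pc (all-filter P? xs) ,
  λ x x∈xs px → All.lookup (f[argmin]≤f[xs] c ys) (∈-filter⁺ P? x∈xs px)
  where ys = filter P? xs

module _ {V : Set} {E : V → V → Set} where

  onShortestPath-self : ∀ {x z} → OnShortestPath E x x z → z ≡ x
  onShortestPath-self ([] , _ , here refl) = refl
  onShortestPath-self ((_ ∷ _) , shortest , _) with shortest []
  ... | ()

  isHubLabeling⇒self : ∀ {ℓ} → IsHubLabeling E ℓ → ∀ x → ℓ x x ≡ true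
  isHubLabeling⇒self {ℓ} ℓ-hub x with ℓ-hub x x
  ... | z , z∈ , x∋z , _ = subst (λ z → ℓ x z ≡ true) (onShortestPath-self z∈) x∋z

_≟Idx_ : DecidableEquality Idx
i1 ≟Idx i1 = yes refl
i2 ≟Idx i2 = yes refl
i3 ≟Idx i3 = yes refl
i1 ≟Idx i2 = no λ ()
i1 ≟Idx i3 = no λ ()
i2 ≟Idx i1 = no λ ()
i2 ≟Idx i3 = no λ ()
i3 ≟Idx i1 = no λ ()
i3 ≟Idx i2 = no λ ()

∈-allIdx : Complete allIdx
∈-allIdx i1 = here refl
∈-allIdx i2 = there (here refl)
∈-allIdx i3 = there (there (here refl))

depth : Idx → ℕ
depth i1 = 0
depth i2 = 1
depth i3 = 2

pathDist : Idx → Idx → ℕ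
pathDist i j = ∣ depth i - depth j ∣

pathDist-triangle : ∀ i k j → pathDist i j ≤ pathDist i k + pathDist k j
pathDist-triangle i k j = ∣-∣-triangle (depth i) (depth k) (depth j)

pathDist≤depth+depth : ∀ i j → pathDist i j ≤ depth i + depth j
pathDist≤depth+depth i j = ≤-trans (∣m-n∣≤m⊔n (depth i) (depth j)) (m⊔n≤m+n (depth i) (depth j))

∑Idx : (Idx → ℕ) → ℕ
∑Idx h = sum (map h allIdx)

∑Idx-cong : ∀ {g h : Idx → ℕ} → (∀ i → g i ≡ h i) → ∑Idx g ≡ ∑Idx h
∑Idx-cong g≗h = cong₂ _+_ (g≗h i1) (cong₂ _+_ (g≗h i2) (cong (_+ 0) (g≗h i3)))

∑Idx-+ : ∀ (g h : Idx → ℕ) → ∑Idx (λ i → g i + h i) ≡ ∑Idx g + ∑Idx h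
∑Idx-+ g h = regroup (g i1) (g i2) (g i3) (h i1) (h i2) (h i3)
  where regroup : ∀ a b c d e f → (a + d) + ((b + e) + ((c + f) + 0)) ≡ (a + (b + (c + 0))) + (d + (e + (f + 0)))
        regroup = solve-∀

∑Idx-∑ : ∀ {m} (g : Idx → Fin m → ℕ) → ∑Idx (λ i → ∑[ y < m ] g i y) ≡ ∑[ y < m ] ∑Idx (λ i → g i y)
∑Idx-∑ {m} g = sym (begin
  ∑[ y < m ] (g i1 y + (g i2 y + (g i3 y + 0)))              ≡⟨ ∑-distrib-+ (g i1) _ ⟩
  ∑[ y < m ] g i1 y + ∑[ y < m ] (g i2 y + (g i3 y + 0))     ≡⟨ cong (∑[ y < m ] g i1 y +_) (∑-distrib-+ (g i2) _) ⟩
  ∑[ y < m ] g i1 y + (∑[ y < m ] g i2 y + ∑[ y < m ] (g i3 y + 0))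
    ≡⟨ cong (λ t → ∑[ y < m ] g i1 y + (∑[ y < m ] g i2 y + t))
            (trans (∑-distrib-+ (g i3) (λ _ → 0)) (cong (∑[ y < m ] g i3 y +_) (sum-replicate-zero m))) ⟩
  ∑[ y < m ] g i1 y + (∑[ y < m ] g i2 y + (∑[ y < m ] g i3 y + 0)) ∎)
  where open ≡-Reasoning

term≤∑Idx : ∀ (h : Idx → ℕ) i → h i ≤ ∑Idx h
term≤∑Idx h i1 = m≤m+n _ _
term≤∑Idx h i2 = ≤-trans (m≤m+n _ _) (m≤n+m _ (h i1))
term≤∑Idx h i3 = ≤-trans (m≤m+n _ 0) (≤-trans (m≤n+m _ (h i2)) (m≤n+m _ (h i1)))

term≤∑∑Idx : ∀ {m} (g : Fin m → Idx → ℕ) p i → g p i ≤ ∑[ q < m ] ∑Idx (g q)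
term≤∑∑Idx g p i = ≤-trans (term≤∑Idx (g p) i) (term≤∑ (λ q → ∑Idx (g q)) p)

charge-shape : ∀ t₁ t₂ t₃ t₄ t₅ → (t₁ + t₄) + t₂ + (t₃ + t₅) ≡ t₁ + (t₂ + t₃) + t₄ + t₅
charge-shape = solve-∀

-- rows i₂ and i₃ of a 3×3 block of copies as ∑Idx unfolds them, y being the entry (v₃, v₂) after the trade
trade-≤ : ∀ a b c d {y x₂₃ x₃₂} → y ≤ x₃₂ + x₂₃ →
          (a + (b + 0)) + ((c + (y + (d + 0))) + 0) ≤ (a + (b + (x₂₃ + 0))) + ((c + (x₃₂ + (d + 0))) + 0)
trade-≤ a b c d {y} {x₂₃} {x₃₂} y≤ = begin
  (a + (b + 0)) + ((c + (y + (d + 0))) + 0)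
    ≤⟨ +-monoʳ-≤ (a + (b + 0)) (+-monoˡ-≤ 0 (+-monoʳ-≤ c (+-monoˡ-≤ (d + 0) y≤))) ⟩
  (a + (b + 0)) + ((c + ((x₃₂ + x₂₃) + (d + 0))) + 0) ≡⟨ regroup a b c d x₂₃ x₃₂ ⟩
  (a + (b + (x₂₃ + 0))) + ((c + (x₃₂ + (d + 0))) + 0) ∎
  where
    open ≤-Reasoning
    regroup : ∀ a b c d x₂₃ x₃₂ → (a + (b + 0)) + ((c + ((x₃₂ + x₂₃) + (d + 0))) + 0)
                                 ≡ (a + (b + (x₂₃ + 0))) + ((c + (x₃₂ + (d + 0))) + 0)
    regroup = solve-∀

ellV-shape : ∀ x₁₂ x₁₃ x₂₁ x₂₃ x₃₁ x₃₂ → 1 ≤ x₂₁ → 1 ≤ x₃₂ → 1 ≤ x₃₁ + (x₁₂ + x₁₃) →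
             3 ≤ x₁₂ + x₁₃ + x₂₁ + x₂₃ + x₃₁ + x₃₂
ellV-shape x₁₂ x₁₃ x₂₁ x₂₃ x₃₁ x₃₂ h₂₁ h₃₂ h =
  ≤-trans (+-mono-≤ (+-mono-≤ (+-mono-≤ h₂₁ h₃₂) h) (z≤n {x₂₃})) (≤-reflexive (regroup x₁₂ x₁₃ x₂₁ x₂₃ x₃₁ x₃₂))
  where regroup : ∀ x₁₂ x₁₃ x₂₁ x₂₃ x₃₁ x₃₂ → x₂₁ + x₃₂ + (x₃₁ + (x₁₂ + x₁₃)) + x₂₃ ≡ x₁₂ + x₁₃ + x₂₁ + x₂₃ + x₃₁ + x₃₂
        regroup = solve-∀

ellUV-shape : ∀ x₁₁ x₁₂ x₁₃ x₂₁ x₂₂ x₂₃ x₃₁ x₃₂ x₃₃ → 1 ≤ x₁₁ → 1 ≤ x₁₂ → 1 ≤ x₂₁ → 1 ≤ x₂₂ →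
              3 < x₁₁ + (x₁₂ + (x₁₃ + (x₂₁ + (x₂₂ + (x₂₃ + (x₃₁ + (x₃₂ + (x₃₃ + 0))))))))
ellUV-shape x₁₁ x₁₂ x₁₃ x₂₁ x₂₂ x₂₃ x₃₁ x₃₂ x₃₃ h₁₁ h₁₂ h₂₁ h₂₂ =
  +-mono-≤ h₁₁ (+-mono-≤ h₁₂ (+-mono-≤ (z≤n {x₁₃}) (+-mono-≤ h₂₁ (+-mono-≤ h₂₂ (z≤n {x₂₃ + (x₃₁ + (x₃₂ + (x₃₃ + 0)))})))))

-- the hypothesis says that k lies on a shortest path from i to i1
towards-i1 : ∀ i k → pathDist i k + depth k ≡ depth i → i ≢ i3 → k ≡ i ⊎ (i ≡ i2 × k ≡ i1)
towards-i1 i1 i1 _  _   = inj₁ refl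
towards-i1 i2 i1 _  _   = inj₂ (refl , refl)
towards-i1 i2 i2 _  _   = inj₁ refl
towards-i1 i3 _  _  i≢3 = ⊥-elim (i≢3 refl)
towards-i1 i1 i2 () _
towards-i1 i1 i3 () _
towards-i1 i2 i3 () _

module Reduction (n γ : ℕ) (a : Fin n → Fin n → Bool) (a-irrefl : ∀ u → a u u ≡ false) where

  V : Set
  V = CV n γ

  Adj : V → V → Set
  Adj = CAdj {n} {γ} a

  -- Distances and shortest paths

  linkDist : Fin n → Fin n → ℕ
  linkDist p q = if a p q then 1 else 2

  copyDist : Fin n → Idx → Fin n → Idx → ℕ
  copyDist p i q j = if does (p Fin.≟ q) then pathDist i j else depth i + depth j + linkDist p q

  -- shortest walks pass through w, except inside a path v₁v₂v₃ and across an edge u₁v₁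
  dist : V → V → ℕ
  dist hub      hub      = 0
  dist hub      (wv _)   = 1
  dist hub      (vv _ j) = suc (depth j)
  dist (wv x)   hub      = 1
  dist (wv x)   (wv y)   = if does (x Fin.≟ y) then 0 else 2
  dist (wv _)   (vv _ j) = 2 + depth j
  dist (vv _ i) hub      = suc (depth i)
  dist (vv _ i) (wv _)   = 2 + depth i
  dist (vv p i) (vv q j) = copyDist p i q j

  1≤linkDist : ∀ p q → 1 ≤ linkDist p q
  1≤linkDist p q with a p q
  ... | true  = s≤s z≤n
  ... | false = s≤s z≤n

  linkDist≤2 : ∀ p q → linkDist p q ≤ 2
  linkDist≤2 p q with a p q
  ... | true  = ≤-eval
  ... | false = ≤-eval

  linkDist-adjacent : ∀ {p q} → a p q ≡ true → linkDist p q ≡ 1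
  linkDist-adjacent p~q rewrite p~q = refl

  adjacent⇒≢ : ∀ {p q} → a p q ≡ true → p ≢ q
  adjacent⇒≢ {p} p~q refl with trans (sym p~q) (a-irrefl p)
  ... | ()

  copyDist-cases : ∀ p i q j → (p ≡ q × copyDist p i q j ≡ pathDist i j)
                             ⊎ (p ≢ q × copyDist p i q j ≡ depth i + depth j + linkDist p q)
  copyDist-cases p i q j with p Fin.≟ q
  ... | yes p≡q = inj₁ (p≡q , refl)
  ... | no  p≢q = inj₂ (p≢q , refl)

  copyDist-same : ∀ p i j → copyDist p i p j ≡ pathDist i j
  copyDist-same p i j with copyDist-cases p i p j
  ... | inj₁ (_ , eq)   = eq
  ... | inj₂ (p≢p , _) = ⊥-elim (p≢p refl)

  copyDist-distinct : ∀ {p q} i j → p ≢ q → copyDist p i q j ≡ depth i + depth j + linkDist p q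
  copyDist-distinct {p} {q} i j p≢q with copyDist-cases p i q j
  ... | inj₁ (p≡q , _) = ⊥-elim (p≢q p≡q)
  ... | inj₂ (_ , eq)  = eq

  copyDist≤ : ∀ p i q j → copyDist p i q j ≤ depth i + depth j + 2
  copyDist≤ p i q j with copyDist-cases p i q j
  ... | inj₁ (_ , eq) = ≤-trans (≤-reflexive eq) (≤-trans (pathDist≤depth+depth i j) (m≤m+n _ 2))
  ... | inj₂ (_ , eq) = ≤-trans (≤-reflexive eq) (+-monoʳ-≤ (depth i + depth j) (linkDist≤2 p q))

  dist-step : ∀ {u x} → Adj u x → ∀ v → dist u v ≤ suc (dist x v)
  dist-step (w-v1 p) hub      = z≤n
  dist-step (w-v1 p) (wv y)   = ≤-eval
  dist-step (w-v1 p) (vv q j) with p Fin.≟ q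
  ... | yes refl = ≤-refl
  ... | no  _    = s≤s (m≤m+n (depth j) (linkDist p q))
  dist-step (v1-w p) hub      = ≤-eval
  dist-step (v1-w p) (wv y)   = ≤-eval
  dist-step (v1-w p) (vv q j) with p Fin.≟ q
  ... | yes refl = m≤n+m (depth j) 2
  ... | no  _    = ≤-trans (+-monoʳ-≤ (depth j) (linkDist≤2 p q)) (≤-reflexive (+-comm (depth j) 2))
  dist-step (v1-v2 p) hub      = ≤-eval
  dist-step (v1-v2 p) (wv y)   = ≤-eval
  dist-step (v1-v2 p) (vv q j) with p Fin.≟ q
  ... | yes refl = pathDist-triangle i1 i2 j
  ... | no  _    = ≤-trans (n≤1+n _) (n≤1+n _)
  dist-step (v2-v1 p) hub      = ≤-eval
  dist-step (v2-v1 p) (wv y)   = ≤-eval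
  dist-step (v2-v1 p) (vv q j) with p Fin.≟ q
  ... | yes refl = pathDist-triangle i2 i1 j
  ... | no  _    = ≤-refl
  dist-step (v2-v3 p) hub      = ≤-eval
  dist-step (v2-v3 p) (wv y)   = ≤-eval
  dist-step (v2-v3 p) (vv q j) with p Fin.≟ q
  ... | yes refl = pathDist-triangle i2 i3 j
  ... | no  _    = ≤-trans (n≤1+n _) (n≤1+n _)
  dist-step (v3-v2 p) hub      = ≤-eval
  dist-step (v3-v2 p) (wv y)   = ≤-eval
  dist-step (v3-v2 p) (vv q j) with p Fin.≟ q
  ... | yes refl = pathDist-triangle i3 i2 j
  ... | no  _    = ≤-refl
  dist-step (w-W x) hub      = z≤n
  dist-step (w-W x) (wv y) with x Fin.≟ y
  ... | yes _ = ≤-eval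
  ... | no  _ = ≤-eval
  dist-step (w-W x) (vv q j) = s≤s (≤-trans (n≤1+n _) (n≤1+n _))
  dist-step (W-w x) hub      = ≤-eval
  dist-step (W-w x) (wv y) with x Fin.≟ y
  ... | yes _ = ≤-eval
  ... | no  _ = ≤-eval
  dist-step (W-w x) (vv q j) = ≤-refl
  dist-step (u1-v1 p p' p~p') hub    = ≤-eval
  dist-step (u1-v1 p p' p~p') (wv y) = ≤-eval
  dist-step (u1-v1 p p' p~p') (vv q j) with p Fin.≟ q | p' Fin.≟ q
  ... | yes refl | yes refl = ⊥-elim (adjacent⇒≢ p~p' refl)
  ... | yes refl | no _ = ≤-trans (m≤m+n (depth j) (linkDist p' p)) (n≤1+n _)
  ... | no _ | yes refl rewrite linkDist-adjacent p~p' = ≤-reflexive (+-comm (depth j) 1)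
  ... | no _ | no _ =
    ≤-trans (+-monoʳ-≤ (depth j) (≤-trans (linkDist≤2 p q) (+-monoʳ-≤ 1 (1≤linkDist p' q))))
            (≤-reflexive (+-suc (depth j) (linkDist p' q)))

  W : V → V → Set
  W = Walk Adj

  length : ∀ {u v} → W u v → ℕ
  length = len Adj

  _++ʷ_ : ∀ {u x v} → W u x → W x v → W u v
  []      ++ʷ q = q
  (s ∷ p) ++ʷ q = s ∷ (p ++ʷ q)

  length-++ʷ : ∀ {u x v} (p : W u x) (q : W x v) → length (p ++ʷ q) ≡ length p + length q
  length-++ʷ []      q = refl
  length-++ʷ (s ∷ p) q = cong suc (length-++ʷ p q)

  ∈-verts-++ʷ : ∀ {u x v} (p : W u x) (q : W x v) → x ∈ verts Adj (p ++ʷ q)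
  ∈-verts-++ʷ []      []      = here refl
  ∈-verts-++ʷ []      (s ∷ q) = here refl
  ∈-verts-++ʷ (s ∷ p) q       = there (∈-verts-++ʷ p q)

  splitAt : ∀ {u v x} (w : W u v) → x ∈ verts Adj w →
            Σ (W u x) λ w₁ → Σ (W x v) λ w₂ → length w₁ + length w₂ ≡ length w
  splitAt []      (here refl) = [] , [] , refl
  splitAt (s ∷ w) (here refl) = [] , s ∷ w , refl
  splitAt (s ∷ w) (there x∈w) with splitAt w x∈w
  ... | w₁ , w₂ , eq = s ∷ w₁ , w₂ , cong suc eq

  dist-refl : ∀ u → dist u u ≡ 0
  dist-refl hub      = refl
  dist-refl (wv x) with x Fin.≟ x
  ... | yes _   = refl
  ... | no  x≢x = ⊥-elim (x≢x refl)
  dist-refl (vv p i) = trans (copyDist-same p i i) (∣n-n∣≡0 (depth i))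

  dist≤length : ∀ {u v} (w : W u v) → dist u v ≤ length w
  dist≤length {u} []          = ≤-reflexive (dist-refl u)
  dist≤length {v = v} (s ∷ w) = ≤-trans (dist-step s v) (s≤s (dist≤length w))

  ascend : ∀ p i → W (vv p i) (vv p i1)
  ascend p i1 = []
  ascend p i2 = v2-v1 p ∷ []
  ascend p i3 = v3-v2 p ∷ v2-v1 p ∷ []

  descend : ∀ p j → W (vv p i1) (vv p j)
  descend p i1 = []
  descend p i2 = v1-v2 p ∷ []
  descend p i3 = v1-v2 p ∷ v2-v3 p ∷ []

  length-ascend-++ʷ : ∀ p i {v} (w : W (vv p i1) v) → length (ascend p i ++ʷ w) ≡ depth i + length w
  length-ascend-++ʷ p i1 w = refl
  length-ascend-++ʷ p i2 w = refl
  length-ascend-++ʷ p i3 w = refl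

  length-descend : ∀ p j → length (descend p j) ≡ depth j
  length-descend p i1 = refl
  length-descend p i2 = refl
  length-descend p i3 = refl

  Geodesic : V → V → Set
  Geodesic u v = Σ (W u v) λ w → length w ≡ dist u v

  pathGeodesic : ∀ p i j → Σ (W (vv p i) (vv p j)) λ w → length w ≡ pathDist i j
  pathGeodesic p i1 i1 = [] , refl
  pathGeodesic p i1 i2 = v1-v2 p ∷ [] , refl
  pathGeodesic p i1 i3 = v1-v2 p ∷ v2-v3 p ∷ [] , refl
  pathGeodesic p i2 i1 = v2-v1 p ∷ [] , refl
  pathGeodesic p i2 i2 = [] , refl
  pathGeodesic p i2 i3 = v2-v3 p ∷ [] , refl
  pathGeodesic p i3 i1 = v3-v2 p ∷ v2-v1 p ∷ [] , refl
  pathGeodesic p i3 i2 = v3-v2 p ∷ [] , refl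
  pathGeodesic p i3 i3 = [] , refl

  geodesic : ∀ u v → Geodesic u v
  geodesic hub      hub      = [] , refl
  geodesic hub      (wv y)   = w-W y ∷ [] , refl
  geodesic hub      (vv q j) = w-v1 q ∷ descend q j , cong suc (length-descend q j)
  geodesic (wv x)   hub      = W-w x ∷ [] , refl
  geodesic (wv x)   (wv y) with x Fin.≟ y
  ... | yes refl = [] , refl
  ... | no  _    = W-w x ∷ w-W y ∷ [] , refl
  geodesic (wv x)   (vv q j) = W-w x ∷ w-v1 q ∷ descend q j , cong (2 +_) (length-descend q j)
  geodesic (vv p i) hub      = ascend p i ++ʷ (v1-w p ∷ []) , trans (length-ascend-++ʷ p i _) (+-comm (depth i) 1)
  geodesic (vv p i) (wv y)   = ascend p i ++ʷ (v1-w p ∷ w-W y ∷ []) , trans (length-ascend-++ʷ p i _) (+-comm (depth i) 2)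
  geodesic (vv p i) (vv q j) with p Fin.≟ q
  ... | yes refl = pathGeodesic p i j
  ... | no  _ with a p q in p~q
  ...   | true  = ascend p i ++ʷ (u1-v1 p q p~q ∷ descend q j) , (begin
          length (ascend p i ++ʷ (u1-v1 p q p~q ∷ descend q j)) ≡⟨ length-ascend-++ʷ p i _ ⟩
          depth i + suc (length (descend q j))                  ≡⟨ cong (λ t → depth i + suc t) (length-descend q j) ⟩
          depth i + suc (depth j)                                ≡⟨ +-suc (depth i) (depth j) ⟩
          suc (depth i + depth j)                                ≡⟨ +-comm 1 (depth i + depth j) ⟩
          depth i + depth j + 1                                  ∎)
    where open ≡-Reasoning
  ...   | false = ascend p i ++ʷ (v1-w p ∷ w-v1 q ∷ descend q j) , (begin
          length (ascend p i ++ʷ (v1-w p ∷ w-v1 q ∷ descend q j)) ≡⟨ length-ascend-++ʷ p i _ ⟩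
          depth i + (2 + length (descend q j))                    ≡⟨ cong (λ t → depth i + (2 + t)) (length-descend q j) ⟩
          depth i + (2 + depth j)                                 ≡⟨ cong (depth i +_) (+-comm 2 (depth j)) ⟩
          depth i + (depth j + 2)                                 ≡⟨ +-assoc (depth i) (depth j) 2 ⟨
          depth i + depth j + 2                                   ∎)
    where open ≡-Reasoning

  OnShortest : V → V → V → Set
  OnShortest = OnShortestPath Adj

  onShortest⇒dist : ∀ {u v x} → OnShortest u v x → dist u x + dist x v ≡ dist u v
  onShortest⇒dist {u} {v} {x} (w , w-shortest , x∈w) with splitAt w x∈w
  ... | w₁ , w₂ , eq = ≤-antisym
    (≤-trans (+-mono-≤ (dist≤length w₁) (dist≤length w₂))
             (≤-trans (≤-reflexive eq) (≤-trans (w-shortest (proj₁ (geodesic u v))) (≤-reflexive (proj₂ (geodesic u v))))))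
    (≤-trans (dist≤length (proj₁ (geodesic u x) ++ʷ proj₁ (geodesic x v)))
             (≤-reflexive (trans (length-++ʷ (proj₁ (geodesic u x)) _)
                                 (cong₂ _+_ (proj₂ (geodesic u x)) (proj₂ (geodesic x v))))))

  dist⇒onShortest : ∀ {u v x} → dist u x + dist x v ≡ dist u v → OnShortest u v x
  dist⇒onShortest {u} {v} {x} eq = w , w-shortest , ∈-verts-++ʷ (proj₁ (geodesic u x)) (proj₁ (geodesic x v))
    where
      w = proj₁ (geodesic u x) ++ʷ proj₁ (geodesic x v)
      w-shortest : Shortest Adj w
      w-shortest q = ≤-trans (≤-reflexive (trans (length-++ʷ (proj₁ (geodesic u x)) _)
                                             (trans (cong₂ _+_ (proj₂ (geodesic u x)) (proj₂ (geodesic x v))) eq)))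
                             (dist≤length q)

  onShortest? : ∀ u v x → Dec (OnShortest u v x)
  onShortest? u v x = map′ dist⇒onShortest onShortest⇒dist (dist u x + dist x v ≟ dist u v)

  onShortest-source : ∀ u v → OnShortest u v u
  onShortest-source u v = dist⇒onShortest (cong (_+ dist u v) (dist-refl u))

  onShortest-target : ∀ u v → OnShortest u v v
  onShortest-target u v = dist⇒onShortest (trans (cong (dist u v +_) (dist-refl v)) (+-identityʳ _))

  onShortest-W-hub : ∀ y z → OnShortest (wv y) hub z → z ≡ wv y ⊎ z ≡ hub
  onShortest-W-hub y z z∈ = go z (onShortest⇒dist z∈)
    where
      go : ∀ z → dist (wv y) z + dist z hub ≡ 1 → z ≡ wv y ⊎ z ≡ hub
      go hub      _ = inj₂ refl
      go (wv y') eq with y Fin.≟ y'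
      ... | yes refl = inj₁ refl
      go (wv y') () | no _

  -- leaving the copies of a vertex costs at least one step out and one step back
  detour : ∀ m k n {x y} → 1 ≤ x → 1 ≤ y → 2 + (m + n) ≤ (m + k + x) + (k + n + y)
  detour m k n {x} {y} 1≤x 1≤y = begin
    2 + (m + n)           ≡⟨ regroup m n ⟨
    (m + 1) + (n + 1)     ≤⟨ +-mono-≤ (+-monoʳ-≤ m 1≤x) (+-monoʳ-≤ n 1≤y) ⟩
    (m + x) + (n + y)     ≤⟨ +-mono-≤ (+-monoˡ-≤ x (m≤m+n m k)) (+-monoˡ-≤ y (m≤n+m n k)) ⟩
    (m + k + x) + (k + n + y) ∎
    where
      open ≤-Reasoning
      regroup : ∀ m n → (m + 1) + (n + 1) ≡ 2 + (m + n)
      regroup = solve-∀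

  data CopyView (p q : Fin n) : V → Set where
    copy-of-p : ∀ k → CopyView p q (vv p k)
    copy-of-q : ∀ k → CopyView p q (vv q k)
    elsewhere : ∀ {z} → (∀ i j → 2 + (depth i + depth j) ≤ dist (vv p i) z + dist z (vv q j)) → CopyView p q z

  copyView : ∀ p q z → CopyView p q z
  copyView p q hub      = elsewhere λ i j → s≤s (≤-reflexive (sym (+-suc (depth i) (depth j))))
  copyView p q (wv y)   = elsewhere λ i j →
    ≤-trans (s≤s (≤-reflexive (sym (+-suc (depth i) (depth j))))) (+-mono-≤ (n≤1+n (suc (depth i))) (n≤1+n (suc (depth j))))
  copyView p q (vv r k) with r Fin.≟ p | r Fin.≟ q
  ... | yes refl | _        = copy-of-p k
  ... | no  _    | yes refl = copy-of-q k
  ... | no  r≢p  | no  r≢q  = elsewhere λ i j →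
    subst (2 + (depth i + depth j) ≤_)
          (sym (cong₂ _+_ (copyDist-distinct i k (r≢p ∘ sym)) (copyDist-distinct k j r≢q)))
          (detour (depth i) (depth k) (depth j) (1≤linkDist p r) (1≤linkDist r q))

  ¬onShortest-W : ∀ p i q j y → ¬ OnShortest (vv p i) (vv q j) (wv y)
  ¬onShortest-W p i q j y y∈ = ≤⇒≯ (≤-trans (≤-reflexive (onShortest⇒dist y∈)) (copyDist≤ p i q j)) (far i j)
    where
      far : ∀ i j → depth i + depth j + 2 < (2 + depth i) + (2 + depth j)
      far i j = ≤-trans (≤-reflexive (regroup (depth i) (depth j))) (n≤1+n _)
        where regroup : ∀ m n → suc (m + n + 2) ≡ suc (m + (2 + n))
              regroup = solve-∀

  pathDist-via : ∀ p i k j → copyDist p i p k + copyDist p k p j ≡ copyDist p i p j →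
                 pathDist i k + pathDist k j ≡ pathDist i j
  pathDist-via p i k j rewrite copyDist-same p i k | copyDist-same p k j | copyDist-same p i j = λ eq → eq

  onShortest-path : ∀ p i j z → OnShortest (vv p i) (vv p j) z →
                    ∃ λ k → z ≡ vv p k × pathDist i k + pathDist k j ≡ pathDist i j
  onShortest-path p i j z z∈ with copyView p p z | onShortest⇒dist z∈
  ... | copy-of-p k   | eq = k , refl , pathDist-via p i k j eq
  ... | copy-of-q k   | eq = k , refl , pathDist-via p i k j eq
  ... | elsewhere far | eq = ⊥-elim (≤⇒≯ (pathDist≤depth+depth i j)
          (≤-trans (n≤1+n _) (≤-trans (far i j) (≤-reflexive (trans eq (copyDist-same p i j))))))

  dist-link : ∀ {u v} i j → a u v ≡ true → dist (vv u i) (vv v j) ≡ depth i + depth j + 1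
  dist-link i j u~v = trans (copyDist-distinct i j (adjacent⇒≢ u~v)) (cong (depth i + depth j +_) (linkDist-adjacent u~v))

  onShortest-link : ∀ {u v} i j z → a u v ≡ true → OnShortest (vv u i) (vv v j) z →
                    (∃ λ k → z ≡ vv u k × pathDist i k + depth k ≡ depth i)
                    ⊎ (∃ λ k → z ≡ vv v k × pathDist j k + depth k ≡ depth j)
  onShortest-link {u} {v} i j z u~v z∈ with copyView u v z | onShortest⇒dist z∈
  ... | copy-of-p k   | eq = inj₁ (k , refl , +-cancel-tail _ (depth k) (depth i) (depth j)
          (trans (cong₂ _+_ (sym (copyDist-same u i k)) (sym (dist-link k j u~v))) (trans eq (dist-link i j u~v))))
  ... | copy-of-q k   | eq = inj₂ (k , refl , +-cancel-head (depth i) (depth k) _ (depth j)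
          (trans (cong₂ _+_ (sym (dist-link i k u~v)) (trans (∣-∣-comm (depth j) (depth k)) (sym (copyDist-same v k j))))
                 (trans eq (dist-link i j u~v))))
  ... | elsewhere far | eq = ⊥-elim (≤⇒≯ (≤-reflexive (trans eq (dist-link i j u~v)))
          (≤-trans (≤-reflexive (cong suc (+-comm (depth i + depth j) 1))) (far i j)))

  onShortest-pendantʳ : ∀ p v → OnShortest (vv p i2) v (vv p i3) → v ≡ vv p i3
  onShortest-pendantʳ p v v₃∈ = go v (trans (cong (_+ dist (vv p i3) v) (sym (copyDist-same p i2 i3))) (onShortest⇒dist v₃∈))
    where
      go : ∀ v → 1 + dist (vv p i3) v ≡ dist (vv p i2) v → v ≡ vv p i3
      go hub ()
      go (wv _) ()
      go (vv r k) eq with p Fin.≟ r | a p r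
      go (vv r i1) () | yes refl | _
      go (vv r i2) () | yes refl | _
      go (vv r i3) _  | yes refl | _ = refl
      go (vv r i1) () | no _ | true
      go (vv r i2) () | no _ | true
      go (vv r i3) () | no _ | true
      go (vv r i1) () | no _ | false
      go (vv r i2) () | no _ | false
      go (vv r i3) () | no _ | false

  onShortest-pendantˡ : ∀ p u → OnShortest u (vv p i2) (vv p i3) → u ≡ vv p i3
  onShortest-pendantˡ p u u₃∈ = go u (trans (cong (dist u (vv p i3) +_) (sym (copyDist-same p i3 i2))) (onShortest⇒dist u₃∈))
    where
      go : ∀ u → dist u (vv p i3) + 1 ≡ dist u (vv p i2) → u ≡ vv p i3
      go hub ()
      go (wv _) ()
      go (vv r k) eq with r Fin.≟ p | a r p
      go (vv r i1) () | yes refl | _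
      go (vv r i2) () | yes refl | _
      go (vv r i3) _  | yes refl | _ = refl
      go (vv r i1) () | no _ | true
      go (vv r i2) () | no _ | true
      go (vv r i3) () | no _ | true
      go (vv r i1) () | no _ | false
      go (vv r i2) () | no _ | false
      go (vv r i3) () | no _ | false

  -- Normal forms

  Copy : Set
  Copy = Fin n × Idx

  CopyPair : Set
  CopyPair = Copy × Copy

  Restricts : (CopyPair → Bool) → (V → V → Bool) → Set
  Restricts f ℓ = ∀ p i q j → f ((p , i) , (q , j)) ≡ ℓ (vv p i) (vv q j)

  normalPath : (CopyPair → Bool) → Fin n → Idx → Idx → Bool
  normalPath f p i2 i3 = false
  normalPath f p i3 i2 = f ((p , i3) , (p , i2)) ∨ f ((p , i2) , (p , i3))
  normalPath f p i1 k  = f ((p , i1) , (p , k))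
  normalPath f p i2 i1 = f ((p , i2) , (p , i1))
  normalPath f p i2 i2 = f ((p , i2) , (p , i2))
  normalPath f p i3 i1 = f ((p , i3) , (p , i1))
  normalPath f p i3 i3 = f ((p , i3) , (p , i3))

  normalCopies : (CopyPair → Bool) → Fin n → Idx → Fin n → Idx → Bool
  normalCopies f p i q k = if does (p Fin.≟ q) then normalPath f p i k else f ((p , i) , (q , k))

  normal : (CopyPair → Bool) → V → V → Bool
  normal f _        hub      = true
  normal f hub      (wv _)   = false
  normal f (wv x)   (wv y)   = does (x Fin.≟ y)
  normal f (vv _ _) (wv _)   = false
  normal f (vv p i) (vv q k) = normalCopies f p i q k
  normal f _        (vv _ _) = false

  normal-W-self : ∀ f x → normal f (wv x) (wv x) ≡ true
  normal-W-self f x = dec-true (x Fin.≟ x) refl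

  normalCopies-same : ∀ f p i k → normalCopies f p i p k ≡ normalPath f p i k
  normalCopies-same f p i k rewrite dec-true (p Fin.≟ p) refl = refl

  normal-23 : ∀ f p → normal f (vv p i2) (vv p i3) ≡ false
  normal-23 f p = normalCopies-same f p i2 i3

  normal-32 : ∀ f p → f ((p , i2) , (p , i3)) ≡ true → normal f (vv p i3) (vv p i2) ≡ true
  normal-32 f p f₂₃ = trans (normalCopies-same f p i3 i2) (trans (cong (f ((p , i3) , (p , i2)) ∨_) f₂₃) (Bool.∨-zeroʳ _))

  Traded : Fin n → Idx → Fin n → Idx → Set
  Traded p i q k = p ≡ q × i ≡ i2 × k ≡ i3

  traded? : ∀ p i q k → Dec (Traded p i q k)
  traded? p i q k = p Fin.≟ q ×-dec i ≟Idx i2 ×-dec k ≟Idx i3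

  normal-kept : ∀ f p i q k → f ((p , i) , (q , k)) ≡ true → ¬ Traded p i q k → normal f (vv p i) (vv q k) ≡ true
  normal-kept f p i q k f∋ ¬traded with p Fin.≟ q
  ... | no  _    = f∋
  ... | yes refl with i | k
  ... | i1 | i1 = f∋
  ... | i1 | i2 = f∋
  ... | i1 | i3 = f∋
  ... | i2 | i1 = f∋
  ... | i2 | i2 = f∋
  ... | i2 | i3 = ⊥-elim (¬traded (refl , refl , refl))
  ... | i3 | i1 = f∋
  ... | i3 | i2 = cong (_∨ f ((p , i2) , (p , i3))) f∋
  ... | i3 | i3 = f∋

  module _ {ℓ : V → V → Bool} (ℓ-hub : IsHubLabeling Adj ℓ) {f : CopyPair → Bool} (f≗ℓ : Restricts f ℓ) where

    private
      Covered : V → V → Set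
      Covered u v = ∃ λ x → OnShortest u v x × normal f u x ≡ true × normal f v x ≡ true

      normal-self : ∀ p i → normal f (vv p i) (vv p i) ≡ true
      normal-self p i = normal-kept f p i p i (trans (f≗ℓ p i p i) (isHubLabeling⇒self ℓ-hub (vv p i))) λ { (_ , refl , ()) }

      -- a traded hub v₃ of (v₂, x) forces x = v₃, and then v₂ serves instead
      covered-copies : ∀ p i q j r k → OnShortest (vv p i) (vv q j) (vv r k) →
                       ℓ (vv p i) (vv r k) ≡ true → ℓ (vv q j) (vv r k) ≡ true → Covered (vv p i) (vv q j)
      covered-copies p i q j r k r∈ ℓ₁ ℓ₂ with traded? p i r k | traded? q j r k
      ... | yes (refl , refl , refl) | _ with onShortest-pendantʳ p (vv q j) r∈
      ...   | refl = vv p i2 , onShortest-source (vv p i2) (vv p i3) ,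
                     normal-self p i2 , normal-32 f p (trans (f≗ℓ p i2 p i3) ℓ₁)
      covered-copies p i q j r k r∈ ℓ₁ ℓ₂ | no _ | yes (refl , refl , refl) with onShortest-pendantˡ q (vv p i) r∈
      ...   | refl = vv q i2 , onShortest-target (vv q i3) (vv q i2) ,
                     normal-32 f q (trans (f≗ℓ q i2 q i3) ℓ₂) , normal-self q i2
      covered-copies p i q j r k r∈ ℓ₁ ℓ₂ | no ¬t₁ | no ¬t₂ =
        vv r k , r∈ , normal-kept f p i r k (trans (f≗ℓ p i r k) ℓ₁) ¬t₁ , normal-kept f q j r k (trans (f≗ℓ q j r k) ℓ₂) ¬t₂

    normal-isHubLabeling : IsHubLabeling Adj (normal f)
    normal-isHubLabeling hub      v        = hub , onShortest-source hub v , refl , refl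
    normal-isHubLabeling u        hub      = hub , onShortest-target u hub , refl , refl
    normal-isHubLabeling (wv y)   (wv y′) with y Fin.≟ y′
    ... | yes refl = wv y , onShortest-source (wv y) (wv y) , normal-W-self f y , normal-W-self f y
    ... | no  y≢y′ = hub , dist⇒onShortest via-hub , refl , refl
      where via-hub : 2 ≡ dist (wv y) (wv y′)
            via-hub rewrite dec-false (y Fin.≟ y′) y≢y′ = refl
    normal-isHubLabeling (wv y)   (vv q j) = hub , dist⇒onShortest refl , refl , refl
    normal-isHubLabeling (vv p i) (wv y)   = hub , dist⇒onShortest (+-comm (suc (depth i)) 1) , refl , refl
    normal-isHubLabeling (vv p i) (vv q j) with ℓ-hub (vv p i) (vv q j)
    ... | hub    , w∈ , _  , _  = hub , w∈ , refl , refl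
    ... | wv y   , y∈ , _  , _  = ⊥-elim (¬onShortest-W p i q j y y∈)
    ... | vv r k , r∈ , ℓ₁ , ℓ₂ = covered-copies p i q j r k r∈ ℓ₁ ℓ₂

  -- Sizes

  ∑V : (V → ℕ) → ℕ
  ∑V g = g hub + (∑[ y < γ ] g (wv y) + ∑[ p < n ] ∑Idx (λ i → g (vv p i)))

  sum-allCV : ∀ g → sum (map g (allCV n γ)) ≡ ∑V g
  sum-allCV g = cong (g hub +_) (begin
    sum (map g (map wv (allFin γ) ++ copies))            ≡⟨ cong sum (map-++ g (map wv (allFin γ)) copies) ⟩
    sum (map g (map wv (allFin γ)) ++ map g copies)      ≡⟨ sum-++ (map g (map wv (allFin γ))) _ ⟩
    sum (map g (map wv (allFin γ))) + sum (map g copies) ≡⟨ cong₂ _+_ (trans (cong sum (sym (map-∘ (allFin γ))))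
                                                                             (sum-map-tabulate γ (λ y → y) (g ∘ wv)))
                                                                      (trans (sum-map-concatMap g _ (allFin n))
                                                                             (sum-map-tabulate n (λ p → p) _)) ⟩
    ∑[ y < γ ] g (wv y) + ∑[ p < n ] ∑Idx (λ i → g (vv p i)) ∎)
    where
      open ≡-Reasoning
      copies = concatMap (λ p → map (vv {n} {γ} p) allIdx) (allFin n)

  ∑V-cong : ∀ {g h : V → ℕ} → (∀ x → g x ≡ h x) → ∑V g ≡ ∑V h
  ∑V-cong g≗h = cong₂ _+_ (g≗h hub) (cong₂ _+_ (sum-cong-≗ (g≗h ∘ wv)) (sum-cong-≗ λ p → ∑Idx-cong (g≗h ∘ vv p)))

  row : (V → V → Bool) → V → ℕ
  row ℓ x = ∑V (λ y → b2n (ℓ x y))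

  labelSize-∑V : ∀ ℓ → labelSize (allCV n γ) ℓ ≡ ∑V (row ℓ)
  labelSize-∑V ℓ = trans (sum-allCV _) (∑V-cong λ x → sum-allCV (λ y → b2n (ℓ x y)))

  rowW rowV : (V → V → Bool) → V → ℕ
  rowW ℓ x = ∑[ y < γ ] b2n (ℓ x (wv y))
  rowV ℓ x = ∑[ q < n ] ∑Idx (λ j → b2n (ℓ x (vv q j)))

  inW : (V → V → Bool) → Fin γ → ℕ
  inW ℓ y = ∑[ p < n ] ∑Idx (λ i → b2n (ℓ (vv p i) (wv y)))

  hubsOfCopies block : (V → V → Bool) → ℕ
  hubsOfCopies ℓ = ∑[ p < n ] ∑Idx (λ i → b2n (ℓ (vv p i) hub))
  block ℓ = ∑[ p < n ] ∑[ q < n ] ∑Idx (λ i → ∑Idx (λ j → b2n (ℓ (vv p i) (vv q j))))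

  -- the pairs (x, ·), (w, x) and (v_i, x): disjoint for distinct x ∈ W
  charge : (V → V → Bool) → Fin γ → ℕ
  charge ℓ y = row ℓ (wv y) + b2n (ℓ hub (wv y)) + inW ℓ y

  rowsV-block : ∀ ℓ → ∑[ p < n ] ∑Idx (λ i → rowV ℓ (vv p i)) ≡ block ℓ
  rowsV-block ℓ = sum-cong-≗ λ p → ∑Idx-∑ (λ i q → ∑Idx (λ j → b2n (ℓ (vv p i) (vv q j))))

  rows-copies : ∀ ℓ → ∑[ p < n ] ∑Idx (λ i → row ℓ (vv p i)) ≡ hubsOfCopies ℓ + (∑[ y < γ ] inW ℓ y + block ℓ)
  rows-copies ℓ = begin
    ∑[ p < n ] ∑Idx (λ i → row ℓ (vv p i))
      ≡⟨ sum-cong-≗ (λ p → trans (∑Idx-+ (λ i → b2n (ℓ (vv p i) hub)) (λ i → rowW ℓ (vv p i) + rowV ℓ (vv p i)))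
                                 (cong (∑Idx (λ i → b2n (ℓ (vv p i) hub)) +_) (∑Idx-+ (λ i → rowW ℓ (vv p i)) (λ i → rowV ℓ (vv p i))))) ⟩
    ∑[ p < n ] (∑Idx (λ i → b2n (ℓ (vv p i) hub)) + (∑Idx (λ i → rowW ℓ (vv p i)) + ∑Idx (λ i → rowV ℓ (vv p i))))
      ≡⟨ trans (∑-distrib-+ (λ p → ∑Idx (λ i → b2n (ℓ (vv p i) hub))) _)
               (cong (hubsOfCopies ℓ +_) (∑-distrib-+ (λ p → ∑Idx (λ i → rowW ℓ (vv p i))) (λ p → ∑Idx (λ i → rowV ℓ (vv p i))))) ⟩
    hubsOfCopies ℓ + (∑[ p < n ] ∑Idx (λ i → rowW ℓ (vv p i)) + ∑[ p < n ] ∑Idx (λ i → rowV ℓ (vv p i)))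
      ≡⟨ cong (λ t → hubsOfCopies ℓ + (t + ∑[ p < n ] ∑Idx (λ i → rowV ℓ (vv p i))))
              (trans (sum-cong-≗ (λ p → ∑Idx-∑ (λ i y → b2n (ℓ (vv p i) (wv y)))))
                     (∑-comm (λ p y → ∑Idx (λ i → b2n (ℓ (vv p i) (wv y)))))) ⟩
    hubsOfCopies ℓ + (∑[ y < γ ] inW ℓ y + ∑[ p < n ] ∑Idx (λ i → rowV ℓ (vv p i)))
      ≡⟨ cong (λ t → hubsOfCopies ℓ + (∑[ y < γ ] inW ℓ y + t)) (rowsV-block ℓ) ⟩
    hubsOfCopies ℓ + (∑[ y < γ ] inW ℓ y + block ℓ) ∎
    where open ≡-Reasoning

  charges : ∀ ℓ → ∑[ y < γ ] charge ℓ y ≡ ∑[ y < γ ] row ℓ (wv y) + rowW ℓ hub + ∑[ y < γ ] inW ℓ y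
  charges ℓ = trans (∑-distrib-+ (λ y → row ℓ (wv y) + b2n (ℓ hub (wv y))) (inW ℓ))
                    (cong (_+ ∑[ y < γ ] inW ℓ y) (∑-distrib-+ (λ y → row ℓ (wv y)) (λ y → b2n (ℓ hub (wv y)))))

  labelSize-≥ : ∀ ℓ → ℓ hub hub ≡ true →
                1 + (∑[ y < γ ] charge ℓ y + (hubsOfCopies ℓ + block ℓ)) ≤ labelSize (allCV n γ) ℓ
  labelSize-≥ ℓ ℓ∋hub = begin
    1 + (∑[ y < γ ] charge ℓ y + (H + K))     ≡⟨ cong (λ t → 1 + (t + (H + K))) (charges ℓ) ⟩
    1 + ((S + A + I) + (H + K))               ≤⟨ m≤m+n _ B ⟩
    1 + ((S + A + I) + (H + K)) + B           ≡⟨ regroup S A I H K B ⟨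
    (1 + (A + B)) + (S + (H + (I + K)))       ≡⟨ cong₂ _+_ (cong (λ b → b2n b + (A + B)) ℓ∋hub) (cong (S +_) (rows-copies ℓ)) ⟨
    ∑V (row ℓ)                                ≡⟨ labelSize-∑V ℓ ⟨
    labelSize (allCV n γ) ℓ                   ∎
    where
      open ≤-Reasoning
      A = rowW ℓ hub
      B = rowV ℓ hub
      S = ∑[ y < γ ] row ℓ (wv y)
      H = hubsOfCopies ℓ
      I = ∑[ y < γ ] inW ℓ y
      K = block ℓ
      regroup : ∀ S A I H K B → (1 + (A + B)) + (S + (H + (I + K))) ≡ 1 + ((S + A + I) + (H + K)) + B
      regroup = solve-∀

  labelSize-normal : ∀ f → labelSize (allCV n γ) (normal f) ≡ 1 + (γ * 2 + (n * 3 + block (normal f)))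
  labelSize-normal f = begin
    labelSize (allCV n γ) L                                           ≡⟨ labelSize-∑V L ⟩
    row L hub + (∑[ y < γ ] row L (wv y) + ∑[ p < n ] ∑Idx (λ i → row L (vv p i)))
      ≡⟨ cong₂ _+_ (cong suc (cong₂ _+_ (sum-replicate-zero γ) (sum-replicate-zero n)))
                   (cong₂ _+_ (trans (sum-cong-≗ row-W) (∑-const γ 2)) copies) ⟩
    1 + (γ * 2 + (n * 3 + block L))                                   ∎
    where
      open ≡-Reasoning
      L = normal f
      row-W : ∀ y → row L (wv y) ≡ 2
      row-W y = cong suc (cong₂ _+_ (∑-indicator y) (sum-replicate-zero n))
      copies : ∑[ p < n ] ∑Idx (λ i → row L (vv p i)) ≡ n * 3 + block L
      copies = begin
        ∑[ p < n ] ∑Idx (λ i → row L (vv p i))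
          ≡⟨ sum-cong-≗ (λ p → trans (∑Idx-cong λ i → cong (λ t → suc (t + rowV L (vv p i))) (sum-replicate-zero γ))
                                      (∑Idx-+ (λ _ → 1) (λ i → rowV L (vv p i)))) ⟩
        ∑[ p < n ] (3 + ∑Idx (λ i → rowV L (vv p i)))   ≡⟨ ∑-distrib-+ (λ _ → 3) (λ p → ∑Idx (λ i → rowV L (vv p i))) ⟩
        ∑[ p < n ] 3 + ∑[ p < n ] ∑Idx (λ i → rowV L (vv p i)) ≡⟨ cong₂ _+_ (∑-const n 3) (rowsV-block L) ⟩
        n * 3 + block L ∎

  allCopies : List Copy
  allCopies = cartesianProduct (allFin n) allIdx

  ∈-allCopies : Complete allCopies
  ∈-allCopies (p , i) = ∈-cartesianProduct⁺ (∈-allFin p) (∈-allIdx i)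

  module _ {ℓ : V → V → Bool} (ℓ-hub : IsHubLabeling Adj ℓ) where

    private
      W-hub-pair : ∀ y → 1 ≤ b2n (ℓ (wv y) hub) + b2n (ℓ hub (wv y))
      W-hub-pair y with ℓ-hub (wv y) hub
      ... | z , z∈ , ℓ₁ , ℓ₂ with onShortest-W-hub y z z∈
      ... | inj₁ refl = 1≤b2n-⊎ (inj₂ ℓ₂)
      ... | inj₂ refl = 1≤b2n-⊎ (inj₁ ℓ₁)

      W-self : ∀ y → 1 ≤ rowW ℓ (wv y)
      W-self y = ≤-trans (1≤b2n (isHubLabeling⇒self ℓ-hub (wv y))) (term≤∑ (λ y′ → b2n (ℓ (wv y) (wv y′))) y)

      charge-regroup : ∀ y → let T₁₄ = b2n (ℓ (wv y) hub) + b2n (ℓ hub (wv y)) in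
                       T₁₄ + rowW ℓ (wv y) + (rowV ℓ (wv y) + inW ℓ y) ≡ charge ℓ y
      charge-regroup y = charge-shape (b2n (ℓ (wv y) hub)) (rowW ℓ (wv y)) (rowV ℓ (wv y)) (b2n (ℓ hub (wv y))) (inW ℓ y)

      2≤charge : ∀ y → 2 ≤ charge ℓ y
      2≤charge y = ≤-trans (+-mono-≤ (+-mono-≤ (W-hub-pair y) (W-self y)) z≤n) (≤-reflexive (charge-regroup y))

      -- the pair (p₀ᵢ₀, y) needs a hub besides w, which costs y a third pair
      3≤charge : ∀ p₀ i₀ → ℓ (vv p₀ i₀) hub ≡ false → ∀ y → 3 ≤ charge ℓ y
      3≤charge p₀ i₀ no-hub y = ≤-trans (third (ℓ-hub (vv p₀ i₀) (wv y))) (≤-reflexive (charge-regroup y))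
        where
          T₁₄ = b2n (ℓ (wv y) hub) + b2n (ℓ hub (wv y))
          T₂  = rowW ℓ (wv y)
          T₃₅ = rowV ℓ (wv y) + inW ℓ y
          third : (∃ λ z → OnShortest (vv p₀ i₀) (wv y) z × ℓ (vv p₀ i₀) z ≡ true × ℓ (wv y) z ≡ true) →
                  3 ≤ T₁₄ + T₂ + T₃₅
          third (hub , _ , ℓ₁ , _) with () ← trans (sym ℓ₁) no-hub
          third (vv q j , _ , _ , ℓ₂) = +-mono-≤ (+-mono-≤ (W-hub-pair y) (W-self y))
            (≤-trans (≤-trans (1≤b2n ℓ₂) (term≤∑∑Idx (λ q j → b2n (ℓ (wv y) (vv q j))) q j)) (m≤m+n _ _))
          third (wv y′ , _ , ℓ₁ , ℓ₂) with y′ Fin.≟ y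
          ... | yes refl = +-mono-≤ (+-mono-≤ (W-hub-pair y) (W-self y))
            (≤-trans (≤-trans (1≤b2n ℓ₁) (term≤∑∑Idx (λ p i → b2n (ℓ (vv p i) (wv y))) p₀ i₀)) (m≤n+m _ _))
          ... | no y′≢y = +-mono-≤ (+-mono-≤ (W-hub-pair y)
            (≤-trans (+-mono-≤ (1≤b2n (isHubLabeling⇒self ℓ-hub (wv y))) (1≤b2n ℓ₂))
                     (two-terms≤∑ (λ y″ → b2n (ℓ (wv y) (wv y″))) (y′≢y ∘ sym)))) (z≤n {T₃₅})

    charges-and-hubs : n * 3 ≤ γ → γ * 2 + n * 3 ≤ ∑[ y < γ ] charge ℓ y + hubsOfCopies ℓ
    charges-and-hubs 3n≤γ with ∃-dec ∈-allCopies (λ (p , i) → ℓ (vv p i) hub Bool.≟ false)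
    ... | yes ((p₀ , i₀) , no-hub) = begin
      γ * 2 + n * 3               ≤⟨ +-monoʳ-≤ (γ * 2) 3n≤γ ⟩
      γ * 2 + γ                   ≡⟨ regroup γ ⟩
      γ * 3                       ≡⟨ ∑-const γ 3 ⟨
      ∑[ y < γ ] 3                ≤⟨ ∑-mono-≤ (3≤charge p₀ i₀ no-hub) ⟩
      ∑[ y < γ ] charge ℓ y       ≤⟨ m≤m+n _ _ ⟩
      ∑[ y < γ ] charge ℓ y + hubsOfCopies ℓ ∎
      where
        open ≤-Reasoning
        regroup : ∀ γ → γ * 2 + γ ≡ γ * 3
        regroup = solve-∀
    ... | no ¬no-hub = +-mono-≤
      (≤-trans (≤-reflexive (sym (∑-const γ 2))) (∑-mono-≤ 2≤charge))
      (≤-trans (≤-reflexive (sym (∑-const n 3))) (∑-mono-≤ λ p →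
        +-mono-≤ (all-hub p i1) (+-mono-≤ (all-hub p i2) (+-mono-≤ (all-hub p i3) z≤n))))
      where all-hub : ∀ p i → 1 ≤ b2n (ℓ (vv p i) hub)
            all-hub p i = 1≤b2n (Bool.¬-not λ no-hub → ¬no-hub ((p , i) , no-hub))

  block-normal≤ : ∀ {ℓ f} → Restricts f ℓ → block (normal f) ≤ block ℓ
  block-normal≤ {ℓ} {f} f≗ℓ = ∑-mono-≤ λ p → ∑-mono-≤ λ q →
    ≤-trans (traded p q) (≤-reflexive (∑Idx-cong λ i → ∑Idx-cong λ j → cong b2n (f≗ℓ p i q j)))
    where
      entry : Fin n → Idx → Fin n → Idx → ℕ
      entry p i q j = b2n (f ((p , i) , (q , j)))
      traded : ∀ p q → ∑Idx (λ i → ∑Idx (λ j → b2n (normalCopies f p i q j))) ≤ ∑Idx (λ i → ∑Idx (entry p i q))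
      traded p q with p Fin.≟ q
      ... | no  _    = ≤-refl
      ... | yes refl = +-monoʳ-≤ (∑Idx (entry p i1 p))
            (trade-≤ (entry p i2 p i1) (entry p i2 p i2) (entry p i3 p i1) (entry p i3 p i3)
                     (b2n-∨ (f ((p , i3) , (p , i2))) (f ((p , i2) , (p , i3)))))

  normal-size≤ : ∀ {ℓ} → IsHubLabeling Adj ℓ → ∀ {f} → Restricts f ℓ → n * 3 ≤ γ →
                 labelSize (allCV n γ) (normal f) ≤ labelSize (allCV n γ) ℓ
  normal-size≤ {ℓ} ℓ-hub {f} f≗ℓ 3n≤γ = begin
    labelSize (allCV n γ) (normal f)                         ≡⟨ labelSize-normal f ⟩
    1 + (γ * 2 + (n * 3 + block (normal f)))                 ≡⟨ cong suc (+-assoc (γ * 2) (n * 3) _) ⟨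
    1 + ((γ * 2 + n * 3) + block (normal f))                 ≤⟨ s≤s (+-mono-≤ (charges-and-hubs ℓ-hub 3n≤γ) (block-normal≤ {ℓ} f≗ℓ)) ⟩
    1 + ((∑[ y < γ ] charge ℓ y + hubsOfCopies ℓ) + block ℓ) ≡⟨ cong suc (+-assoc _ (hubsOfCopies ℓ) (block ℓ)) ⟩
    1 + (∑[ y < γ ] charge ℓ y + (hubsOfCopies ℓ + block ℓ)) ≤⟨ labelSize-≥ ℓ (isHubLabeling⇒self ℓ-hub hub) ⟩
    labelSize (allCV n γ) ℓ                                  ∎
    where open ≤-Reasoning

  -- Properties (1)-(4)

  NStrictSub-irrefl : ∀ {u} → ¬ NStrictSub Adj u u
  NStrictSub-irrefl (_ , _ , x∈N[u] , x∉N[u]) = x∉N[u] x∈N[u]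

  dominated-copies : ∀ p i q j → NStrictSub Adj (vv p i) (vv q j) → q ≡ p × j ≡ i2 × i ≡ i3
  dominated-copies p i1 q j s@(N⊆ , _) with N⊆ hub (inj₂ (v1-w p))
  ... | inj₂ (v1-w _) with N⊆ (vv p i2) (inj₂ (v1-v2 p))
  ...   | inj₂ (v1-v2 _) = ⊥-elim (NStrictSub-irrefl s)
  dominated-copies p i2 q j s@(N⊆ , _) with N⊆ (vv p i3) (inj₂ (v2-v3 p))
  ... | inj₂ (v2-v3 _) = ⊥-elim (NStrictSub-irrefl s)
  ... | inj₁ refl with N⊆ (vv p i1) (inj₂ (v2-v1 p))
  ...   | inj₁ ()
  ...   | inj₂ ()
  dominated-copies p i3 q j s@(N⊆ , _) with N⊆ (vv p i2) (inj₂ (v3-v2 p))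
  ... | inj₁ refl = refl , refl , refl
  ... | inj₂ (v3-v2 _) = ⊥-elim (NStrictSub-irrefl s)
  ... | inj₂ (v1-v2 _) with N⊆ (vv p i3) (inj₁ refl)
  ...   | inj₁ ()
  ...   | inj₂ ()

  normal-dominated : 2 ≤ γ → ∀ f u v → NStrictSub Adj u v → normal f v u ≡ false
  normal-dominated 2≤γ f hub v s@(N⊆ , _) with distinct-pair 2≤γ
  ... | x₀ , x₁ , x₀≢x₁ with N⊆ (wv x₀) (inj₂ (w-W x₀))
  ...   | inj₂ (w-W _) = ⊥-elim (NStrictSub-irrefl s)
  ...   | inj₁ refl with N⊆ (wv x₁) (inj₂ (w-W x₁))
  ...     | inj₁ refl = ⊥-elim (x₀≢x₁ refl)
  ...     | inj₂ ()
  normal-dominated 2≤γ f (wv y)   hub      _ = refl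
  normal-dominated 2≤γ f (wv y)   (vv _ _) _ = refl
  normal-dominated 2≤γ f (wv y)   (wv y′)  s with y′ Fin.≟ y
  ... | yes refl = ⊥-elim (NStrictSub-irrefl s)
  ... | no  _    = refl
  normal-dominated 2≤γ f (vv p i) hub      _ = refl
  normal-dominated 2≤γ f (vv p i) (wv _)   _ = refl
  normal-dominated 2≤γ f (vv p i) (vv q j) s with dominated-copies p i q j s
  ... | refl , refl , refl = normal-23 f p

  normal-W : ∀ f x y → (normal f y (wv x) ≡ true) ⇔ (y ≡ wv x)
  normal-W f x y = mk⇔ (only y) λ { refl → normal-W-self f x }
    where
      only : ∀ y → normal f y (wv x) ≡ true → y ≡ wv x
      only (wv y) y∋x with y Fin.≟ x
      ... | yes refl = refl
      only (wv y) () | no _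

  module _ {ℓ : V → V → Bool} (ℓ-hub : IsHubLabeling Adj ℓ) where

    path-hubs : ∀ p → ℓ (vv p i2) (vv p i3) ≡ false → ℓ (vv p i2) (vv p i1) ≡ true → 2 < ellV ℓ p
    path-hubs p ℓ₂₃≡false ℓ₂₁ = ellV-shape (B i1 i2) (B i1 i3) (B i2 i1) (B i2 i3) (B i3 i1) (B i3 i2) (1≤b2n ℓ₂₁) (1≤b2n ℓ₃₂) (hub₁₃ (ℓ-hub (vv p i1) (vv p i3)))
      where
        ℓ₃₂ : ℓ (vv p i3) (vv p i2) ≡ true
        ℓ₃₂ with ℓ-hub (vv p i2) (vv p i3)
        ... | z , z∈ , ℓ₁ , ℓ₂ with onShortest-path p i2 i3 z z∈
        ... | i1 , refl , ()
        ... | i2 , refl , _ = ℓ₂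
        ... | i3 , refl , _ with () ← trans (sym ℓ₁) ℓ₂₃≡false
        B : Idx → Idx → ℕ
        B i j = b2n (ℓ (vv p i) (vv p j))
        hub₁₃ : (∃ λ z → OnShortest (vv p i1) (vv p i3) z × ℓ (vv p i1) z ≡ true × ℓ (vv p i3) z ≡ true) →
                1 ≤ B i3 i1 + (B i1 i2 + B i1 i3)
        hub₁₃ (z , z∈ , ℓ₁ , ℓ₂) with onShortest-path p i1 i3 z z∈
        ... | i1 , refl , _ = ≤-trans (1≤b2n ℓ₂) (m≤m+n _ _)
        ... | i2 , refl , _ = ≤-trans (1≤b2n ℓ₁) (≤-trans (m≤m+n _ (B i1 i3)) (m≤n+m _ (B i3 i1)))
        ... | i3 , refl , _ = ≤-trans (1≤b2n ℓ₁) (≤-trans (m≤n+m _ (B i1 i2)) (m≤n+m _ (B i3 i1)))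

    link-cover : ∀ {u v} i j → i ≢ i3 → j ≢ i3 → a u v ≡ true →
                 ℓ (vv u i2) (vv u i1) ≡ false → ℓ (vv v i2) (vv v i1) ≡ false →
                 ℓ (vv u i) (vv v j) ≡ true ⊎ ℓ (vv v j) (vv u i) ≡ true
    link-cover i j i≢3 j≢3 u~v ℓᵤ≡false ℓᵥ≡false with ℓ-hub (vv _ i) (vv _ j)
    ... | z , z∈ , ℓ₁ , ℓ₂ with onShortest-link i j z u~v z∈
    ... | inj₁ (k , refl , k∈) with towards-i1 i k k∈ i≢3
    ...   | inj₁ refl = inj₂ ℓ₂
    ...   | inj₂ (refl , refl) with () ← trans (sym ℓ₁) ℓᵤ≡false
    link-cover i j i≢3 j≢3 u~v ℓᵤ≡false ℓᵥ≡false | z , z∈ , ℓ₁ , ℓ₂ | inj₂ (k , refl , k∈) with towards-i1 j k k∈ j≢3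
    ...   | inj₁ refl = inj₁ ℓ₁
    ...   | inj₂ (refl , refl) with () ← trans (sym ℓ₂) ℓᵥ≡false

    link-hubs : ∀ {u v} → a u v ≡ true → ℓ (vv u i2) (vv u i1) ≡ false → ℓ (vv v i2) (vv v i1) ≡ false →
                3 < ellUV ℓ u v
    link-hubs {u} {v} u~v ℓᵤ ℓᵥ =
      ellUV-shape (F i1 i1) (F i1 i2) (F i1 i3) (F i2 i1) (F i2 i2) (F i2 i3) (F i3 i1) (F i3 i2) (F i3 i3)
                  (cover i1 i1 (λ ()) (λ ())) (cover i1 i2 (λ ()) (λ ())) (cover i2 i1 (λ ()) (λ ())) (cover i2 i2 (λ ()) (λ ()))
      where
        F : Idx → Idx → ℕ
        F i j = b2n (ℓ (vv u i) (vv v j)) + b2n (ℓ (vv v j) (vv u i))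
        cover : ∀ i j → i ≢ i3 → j ≢ i3 → 1 ≤ F i j
        cover i j i≢3 j≢3 = 1≤b2n-⊎ (link-cover i j i≢3 j≢3 u~v ℓᵤ ℓᵥ)

  -- Optimality

  ∈-allCV : Complete (allCV n γ)
  ∈-allCV hub      = here refl
  ∈-allCV (wv y)   = there (∈-++⁺ˡ (∈-map⁺ wv (∈-allFin y)))
  ∈-allCV (vv p i) = there (∈-++⁺ʳ (map wv (allFin γ)) (∈-concatMap⁺ _ (lose (∈-allFin p) (∈-map⁺ (vv p) (∈-allIdx i)))))

  isHubLabeling? : ∀ ℓ → Dec (IsHubLabeling Adj ℓ)
  isHubLabeling? ℓ = ∀-dec ∈-allCV λ u → ∀-dec ∈-allCV λ v → ∃-dec ∈-allCV λ x →
    onShortest? u v x ×-dec (ℓ u x Bool.≟ true ×-dec ℓ v x Bool.≟ true)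

  _≟Copy_ : DecidableEquality Copy
  _≟Copy_ = Product.≡-dec Fin._≟_ _≟Idx_

  _≟CopyPair_ : DecidableEquality CopyPair
  _≟CopyPair_ = Product.≡-dec _≟Copy_ _≟Copy_

  allCopyPairs : List CopyPair
  allCopyPairs = cartesianProduct allCopies allCopies

  ∈-allCopyPairs : Complete allCopyPairs
  ∈-allCopyPairs (c , d) = ∈-cartesianProduct⁺ (∈-allCopies c) (∈-allCopies d)

  restrict : (V → V → Bool) → CopyPair → Bool
  restrict ℓ ((p , i) , (q , j)) = ℓ (vv p i) (vv q j)

  optimal-normal : n * 3 ≤ γ → ∀ {ℓ₀} → IsHubLabeling Adj ℓ₀ →
                   ∃ λ f → IsHubLabeling Adj (normal f) ×
                           (∀ ℓ → IsHubLabeling Adj ℓ → labelSize (allCV n γ) (normal f) ≤ labelSize (allCV n γ) ℓ)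
  optimal-normal 3n≤γ {ℓ₀} ℓ₀-hub
    with minimal-in (isHubLabeling? ∘ normal) (labelSize (allCV n γ) ∘ normal) (boolFunctions _≟CopyPair_ allCopyPairs)
                    (normal-isHubLabeling ℓ₀-hub {restrict ℓ₀} λ _ _ _ _ → refl)
  ... | f , f-hub , f-minimal = f , f-hub , beats
    where
      beats : ∀ ℓ → IsHubLabeling Adj ℓ → labelSize (allCV n γ) (normal f) ≤ labelSize (allCV n γ) ℓ
      beats ℓ ℓ-hub with boolFunctions-complete _≟CopyPair_ allCopyPairs (restrict ℓ)
      ... | g , g∈ , g≗ = ≤-trans (f-minimal g g∈ (normal-isHubLabeling ℓ-hub g≗ℓ)) (normal-size≤ ℓ-hub g≗ℓ 3n≤γ)
        where g≗ℓ : Restricts g ℓ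
              g≗ℓ p i q j = g≗ _ (∈-allCopyPairs _)

lemma1 : (n : ℕ) (G' : SimpleGraph n) (k' : ℕ) →
    let a = proj₁ G'
        γ = gammaOf a k'
        k = 3 * γ ∸ 1
        V = allCV n γ
        HL = IsHubLabeling (CAdj {n} {γ} a)
    in (∃ λ (ℓ₀ : CV n γ → CV n γ → Bool) → HL ℓ₀ × labelSize V ℓ₀ ≤ k) →
       ∃ λ (ℓ : CV n γ → CV n γ → Bool) →
         HL ℓ ×
         (∀ ℓ' → HL ℓ' → labelSize V ℓ ≤ labelSize V ℓ') ×
         (∀ u v → NStrictSub (CAdj a) u v → ℓ v u ≡ false) ×
         ((∀ x → ℓ x hub ≡ true) ×
          (∀ (x : Fin γ) (y : CV n γ) → (ℓ y (wv x) ≡ true) ⇔ (y ≡ wv x))) ×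
         (∀ (v : Fin n) → ℓ (vv v i2) (vv v i1) ≡ true → 2 < ellV ℓ v) ×
         (∀ (u v : Fin n) → a u v ≡ true →
            ℓ (vv u i2) (vv u i1) ≡ false → ℓ (vv v i2) (vv v i1) ≡ false →
            3 < ellUV ℓ u v)
lemma1 n (a , _ , a-irrefl) k' (ℓ₀ , ℓ₀-hub , _) =
  let f , f-hub , f-optimal = optimal-normal 3n≤γ ℓ₀-hub in
  normal f , f-hub , f-optimal , normal-dominated 2≤γ f , ((λ _ → refl) , normal-W f) ,
  (λ v → path-hubs f-hub v (normal-23 f v)) , (λ u v u~v → link-hubs f-hub u~v)
  where
    γ = gammaOf a k'
    open Reduction n γ a a-irrefl
    2≤γ : 2 ≤ γ
    2≤γ = m≤n+m 2 (8 * n + 3 * numEdges a + k')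
    3n≤γ : n * 3 ≤ γ
    3n≤γ = begin
      n * 3                              ≡⟨ *-comm n 3 ⟩
      3 * n                              ≤⟨ *-monoˡ-≤ n {3} {8} ≤-eval ⟩
      8 * n                              ≤⟨ m≤m+n (8 * n) (3 * numEdges a) ⟩
      8 * n + 3 * numEdges a             ≤⟨ m≤m+n _ k' ⟩
      8 * n + 3 * numEdges a + k'        ≤⟨ m≤m+n _ 2 ⟩
      γ                                  ∎
      where open ≤-Reasoning
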